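{- Let $w\in S_n$ with $w(1)\neq1$ and let $F:S_n\to S_n$ be any homing shuffle. Then $W(F(w))>W(w)$.
   Context: $[n]=\{1,\dots,n\}$; $S_n$ is the group of bijections $[n]\to[n]$. A homing shuffle is a map $F:S_n\to S_n$ such that for every $w\in S_n$, setting $k:=w(1)$: (a) $F(w)(k)=k$, and (b) $F(w)(i)=w(i)$ for all $i>k$. The Wilf number of $w\in S_n$ is $W(w):=\sum_{i\in[n],\,w(i)=i}2^{i-2}\in\mathbb{Q}_{\ge0}$. -}

module Defs where

open import Data.Nat using (ℕ; zero; suc; _^_)
open import Data.Fin using (Fin; toℕ; _<_; _≟_)
import Data.Fin as Fin
open import Data.Fin.Permutation using (Permutation′; _⟨$⟩ʳ_)
open import Data.Rational using (ℚ; ½; _+_; _*_; 0ℚ)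
open import Data.Integer using (+_)
import Data.Rational as ℚ
open import Data.List using (List; foldr; map; allFin)
open import Relation.Nullary using (yes; no)
open import Relation.Binary.PropositionalEquality using (_≡_)

-- Convention: [n] is represented by Fin n, with 0-based index j standing for j+1.
-- S_n is Permutation′ n (bijections Fin n ↔ Fin n); w(i) is  w ⟨$⟩ʳ i.

-- the (rational) number 2^(j-1), i.e. 2^(i-2) for i = j+1
pow2m : ℕ → ℚ
pow2m j = ½ * (+ (2 ^ j) ℚ./ 1)

contrib : {n : ℕ} → Permutation′ n → Fin n → ℚ
contrib w j with (w ⟨$⟩ʳ j) ≟ j
... | yes _ = pow2m (toℕ j)
... | no  _ = 0ℚ

W : {n : ℕ} → Permutation′ n → ℚ
W {n} w = foldr _+_ 0ℚ (map (contrib w) (allFin n))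

-- Homing shuffle on S_n (n ≥ 1, so that w(1) exists; index 0 = position 1)
IsHomingShuffle : (n : ℕ) → (Permutation′ (suc n) → Permutation′ (suc n)) → Set
IsHomingShuffle n F =
  (w : Permutation′ (suc n)) →
    (F w ⟨$⟩ʳ (w ⟨$⟩ʳ Fin.zero) ≡ (w ⟨$⟩ʳ Fin.zero))
    × ((i : Fin (suc n)) → (w ⟨$⟩ʳ Fin.zero) < i → F w ⟨$⟩ʳ i ≡ w ⟨$⟩ʳ i)
  where open import Data.Product using (_×_)

-- Scaled by 2, the Wilf number is the binary number whose j-th bit (j = i - 1) records whether
-- w fixes i. Put k = w(1) ≠ 1. Then w does not fix k (else w(k) = w(1) gives k = 1), F(w) does,
-- and the two permutations agree above k; since the lower bits weigh at most
-- 2⁰ + ⋯ + 2^(k-2) < 2^(k-1), the number of F(w) is larger.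
module Submission where

open import Defs
open import Data.Nat using (ℕ; suc)
import Data.Fin as Fin
open import Data.Fin.Permutation using (Permutation′; _⟨$⟩ʳ_)
open import Data.Rational using (_<_)
open import Relation.Binary.PropositionalEquality using (_≢_)

open import Algebra.Definitions.RawMonoid Data.Nat.+-0-rawMonoid using (sum)
open import Data.Fin using (Fin; zero; suc; toℕ; _≟_)
open import Data.Fin.Permutation using (_⟨$⟩ˡ_; inverseˡ)
open import Data.Integer as ℤ using (+_)
import Data.Integer.Properties as ℤ
open import Data.List using (foldr; tabulate)
open import Data.List.Properties using (map-tabulate)
open import Data.Nat as ℕ using (_^_; z≤n; s≤s)
import Data.Nat.Coprimality as Coprime
import Data.Nat.Properties as ℕ
open import Data.Product using (proj₁; proj₂)
open import Data.Rational as ℚ using (ℚ; mkℚ; ½; 0ℚ; *<*)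
open import Data.Rational.Properties as ℚ using (normalize-coprime; /-cong)
open import Data.Vec.Functional using (Vector)
open import Function using (_∘_)
open import Relation.Binary.PropositionalEquality
open import Relation.Nullary using (yes; no; contradiction)

ℕ→ℚ : ℕ → ℚ
ℕ→ℚ x = + x ℚ./ 1

ℕ→ℚ≡mkℚ : ∀ x → ℕ→ℚ x ≡ mkℚ (+ x) 0 (Coprime.sym (Coprime.1-coprimeTo x))
ℕ→ℚ≡mkℚ x = normalize-coprime _

ℕ→ℚ-+ : ∀ x y → ℕ→ℚ x ℚ.+ ℕ→ℚ y ≡ ℕ→ℚ (x ℕ.+ y)
ℕ→ℚ-+ x y rewrite ℕ→ℚ≡mkℚ x | ℕ→ℚ≡mkℚ y =
  /-cong (cong₂ ℤ._+_ (ℤ.*-identityʳ (+ x)) (ℤ.*-identityʳ (+ y))) refl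

ℕ→ℚ-mono-< : ∀ {x y} → x ℕ.< y → ℕ→ℚ x < ℕ→ℚ y
ℕ→ℚ-mono-< {x} {y} x<y rewrite ℕ→ℚ≡mkℚ x | ℕ→ℚ≡mkℚ y =
  *<* (subst₂ ℤ._<_ (sym (ℤ.*-identityʳ (+ x))) (sym (ℤ.*-identityʳ (+ y))) (ℤ.+<+ x<y))

foldr-tabulate-scaled : ∀ {n} (c : ℚ) (h : Fin n → ℚ) (f : Vector ℕ n) →
  (∀ j → h j ≡ c ℚ.* ℕ→ℚ (f j)) → foldr ℚ._+_ 0ℚ (tabulate h) ≡ c ℚ.* ℕ→ℚ (sum f)
foldr-tabulate-scaled {ℕ.zero} c h f h≗cf = sym (ℚ.*-zeroʳ c)
foldr-tabulate-scaled {suc n} c h f h≗cf = begin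
  h zero ℚ.+ foldr ℚ._+_ 0ℚ (tabulate (h ∘ suc))
    ≡⟨ cong₂ ℚ._+_ (h≗cf zero) (foldr-tabulate-scaled c (h ∘ suc) (f ∘ suc) (h≗cf ∘ suc)) ⟩
  c ℚ.* ℕ→ℚ (f zero) ℚ.+ c ℚ.* ℕ→ℚ (sum (f ∘ suc))
    ≡⟨ ℚ.*-distribˡ-+ c (ℕ→ℚ (f zero)) (ℕ→ℚ (sum (f ∘ suc))) ⟨
  c ℚ.* (ℕ→ℚ (f zero) ℚ.+ ℕ→ℚ (sum (f ∘ suc)))
    ≡⟨ cong (c ℚ.*_) (ℕ→ℚ-+ (f zero) (sum (f ∘ suc))) ⟩
  c ℚ.* ℕ→ℚ (sum f) ∎
  where open ≡-Reasoning

sum-mono-≤ : ∀ {m} {f g : Vector ℕ m} → (∀ j → f j ℕ.≤ g j) → sum f ℕ.≤ sum g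
sum-mono-≤ {ℕ.zero} f≤g = z≤n
sum-mono-≤ {suc m} f≤g = ℕ.+-mono-≤ (f≤g zero) (sum-mono-≤ (f≤g ∘ suc))

-- Induction on k: when k > 0, the bit of weight c at position 0 is absorbed into the surplus,
-- which doubles it to the weight 2c of the shifted problem.
sum-+-≤-of-leading-weight : ∀ {m} (c : ℕ) (f g : Vector ℕ m) (k : Fin m) →
  (∀ j → j Fin.< k → f j ℕ.≤ c ℕ.* 2 ^ toℕ j) → f k ≡ 0 → c ℕ.* 2 ^ toℕ k ℕ.≤ g k →
  (∀ j → k Fin.< j → f j ℕ.≤ g j) → sum f ℕ.+ c ℕ.≤ sum g
sum-+-≤-of-leading-weight c f g zero f<k fk≡0 gk f≤g>k = begin
  f zero ℕ.+ sum (f ∘ suc) ℕ.+ c  ≡⟨ cong (λ t → t ℕ.+ sum (f ∘ suc) ℕ.+ c) fk≡0 ⟩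
  sum (f ∘ suc) ℕ.+ c             ≡⟨ ℕ.+-comm (sum (f ∘ suc)) c ⟩
  c ℕ.+ sum (f ∘ suc)             ≤⟨ ℕ.+-mono-≤ (subst (ℕ._≤ g zero) (ℕ.*-identityʳ c) gk)
                                                (sum-mono-≤ λ j → f≤g>k (suc j) (s≤s z≤n)) ⟩
  g zero ℕ.+ sum (g ∘ suc)        ∎
  where open ℕ.≤-Reasoning
sum-+-≤-of-leading-weight c f g (suc k) f<k fk≡0 gk f≤g>k = begin
  f zero ℕ.+ sum (f ∘ suc) ℕ.+ c  ≤⟨ ℕ.+-monoˡ-≤ c (ℕ.+-monoˡ-≤ (sum (f ∘ suc)) f₀≤c) ⟩
  c ℕ.+ sum (f ∘ suc) ℕ.+ c       ≡⟨ cong (ℕ._+ c) (ℕ.+-comm c (sum (f ∘ suc))) ⟩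
  sum (f ∘ suc) ℕ.+ c ℕ.+ c       ≡⟨ ℕ.+-assoc (sum (f ∘ suc)) c c ⟩
  sum (f ∘ suc) ℕ.+ (c ℕ.+ c)     ≤⟨ shifted ⟩
  sum (g ∘ suc)                   ≤⟨ ℕ.m≤n+m (sum (g ∘ suc)) (g zero) ⟩
  g zero ℕ.+ sum (g ∘ suc)        ∎
  where
    open ℕ.≤-Reasoning
    double : ∀ x → c ℕ.* (2 ℕ.* x) ≡ (c ℕ.+ c) ℕ.* x
    double x = trans (sym (ℕ.*-assoc c 2 x))
                     (cong (ℕ._* x) (trans (ℕ.*-comm c 2) (cong (c ℕ.+_) (ℕ.+-identityʳ c))))
    f₀≤c : f zero ℕ.≤ c
    f₀≤c = subst (f zero ℕ.≤_) (ℕ.*-identityʳ c) (f<k zero (s≤s z≤n))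
    shifted : sum (f ∘ suc) ℕ.+ (c ℕ.+ c) ℕ.≤ sum (g ∘ suc)
    shifted = sum-+-≤-of-leading-weight (c ℕ.+ c) (f ∘ suc) (g ∘ suc) k
      (λ j j<k → subst (f (suc j) ℕ.≤_) (double (2 ^ toℕ j)) (f<k (suc j) (s≤s j<k)))
      fk≡0 (subst (ℕ._≤ g (suc k)) (double (2 ^ toℕ k)) gk)
      (λ j k<j → f≤g>k (suc j) (s≤s k<j))

sum-<-of-leading-bit : ∀ {m} (f g : Vector ℕ m) (k : Fin m) →
  (∀ j → j Fin.< k → f j ℕ.≤ 2 ^ toℕ j) → f k ≡ 0 → g k ≡ 2 ^ toℕ k →
  (∀ j → k Fin.< j → f j ≡ g j) → sum f ℕ.< sum g
sum-<-of-leading-bit f g k f<k fk≡0 gk f≡g>k =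
  subst (ℕ._≤ sum g) (ℕ.+-comm (sum f) 1)
    (sum-+-≤-of-leading-weight 1 f g k
      (λ j j<k → subst (f j ℕ.≤_) (sym (ℕ.*-identityˡ _)) (f<k j j<k))
      fk≡0
      (ℕ.≤-reflexive (trans (ℕ.*-identityˡ _) (sym gk)))
      (λ j k<j → ℕ.≤-reflexive (f≡g>k j k<j)))

bitIfFixed : ∀ {n} → Fin n → Fin n → ℕ
bitIfFixed v j with v ≟ j
... | yes _ = 2 ^ toℕ j
... | no  _ = 0

bitIfFixed-≤ : ∀ {n} (v j : Fin n) → bitIfFixed v j ℕ.≤ 2 ^ toℕ j
bitIfFixed-≤ v j with v ≟ j
... | yes _ = ℕ.≤-refl
... | no  _ = z≤n

bitIfFixed-refl : ∀ {n} (j : Fin n) → bitIfFixed j j ≡ 2 ^ toℕ j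
bitIfFixed-refl j with j ≟ j
... | yes _   = refl
... | no  j≢j = contradiction refl j≢j

bitIfFixed-≢ : ∀ {n} {v j : Fin n} → v ≢ j → bitIfFixed v j ≡ 0
bitIfFixed-≢ {v = v} {j} v≢j with v ≟ j
... | yes v≡j = contradiction v≡j v≢j
... | no  _   = refl

fixedBits : ∀ {n} → Permutation′ n → Vector ℕ n
fixedBits w j = bitIfFixed (w ⟨$⟩ʳ j) j

contrib≡½*fixedBits : ∀ {n} (w : Permutation′ n) (j : Fin n) →
  contrib w j ≡ ½ ℚ.* ℕ→ℚ (fixedBits w j)
contrib≡½*fixedBits w j with (w ⟨$⟩ʳ j) ≟ j
... | yes _ = refl
... | no  _ = sym (ℚ.*-zeroʳ ½)

W≡½*sum-fixedBits : ∀ {n} (w : Permutation′ n) → W w ≡ ½ ℚ.* ℕ→ℚ (sum (fixedBits w))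
W≡½*sum-fixedBits w = trans (cong (foldr ℚ._+_ 0ℚ) (map-tabulate (λ j → j) (contrib w)))
  (foldr-tabulate-scaled ½ (contrib w) (fixedBits w) (contrib≡½*fixedBits w))

⟨$⟩ʳ-injective : ∀ {n} (w : Permutation′ n) {i j : Fin n} → w ⟨$⟩ʳ i ≡ w ⟨$⟩ʳ j → i ≡ j
⟨$⟩ʳ-injective w wi≡wj = trans (sym (inverseˡ w)) (trans (cong (w ⟨$⟩ˡ_) wi≡wj) (inverseˡ w))

lemma1 : (n : ℕ) (F : Permutation′ (suc n) → Permutation′ (suc n)) →
    IsHomingShuffle n F → (w : Permutation′ (suc n)) →
    w ⟨$⟩ʳ Fin.zero ≢ Fin.zero → W w < W (F w)
lemma1 n F homing w k≢0 =
  subst₂ _<_ (sym (W≡½*sum-fixedBits w)) (sym (W≡½*sum-fixedBits (F w)))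
    (ℚ.*-monoʳ-<-pos ½ (ℕ→ℚ-mono-< bits<))
  where
    k = w ⟨$⟩ʳ zero
    bits< : sum (fixedBits w) ℕ.< sum (fixedBits (F w))
    bits< = sum-<-of-leading-bit (fixedBits w) (fixedBits (F w)) k
      (λ j _ → bitIfFixed-≤ (w ⟨$⟩ʳ j) j)
      (bitIfFixed-≢ (k≢0 ∘ ⟨$⟩ʳ-injective w))
      (trans (cong (λ v → bitIfFixed v k) (proj₁ (homing w))) (bitIfFixed-refl k))
      (λ j k<j → cong (λ v → bitIfFixed v j) (sym (proj₂ (homing w) j k<j)))
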